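{- Let $a\geqslant 3$ be an integer, let $\beta>1$ be a root of $X^2=aX-1$, and let $\mathcal{A}=\{0,1,\ldots,a-1\}$. Then addition in $\mathrm{Fin}_{\mathcal{A}}(\beta)$ can be performed by a digit set conversion in base $\beta$ from $\mathcal{A}+\mathcal{A}$ to $\mathcal{A}$ which is a $p$-local function with $p=11$. Moreover, $\mathcal{A}$ is the smallest alphabet for parallel addition in base $\beta$: no alphabet of contiguous integers containing $0$ and $1$ with fewer than $a$ elements allows parallel addition in base $\beta$.
   Context: For a complex number $\beta$ with $|\beta|>1$ and a finite set $\mathcal{A}\subset\mathbb{C}$ containing $0$, let $\mathrm{Fin}_{\mathcal{A}}(\beta)=\{\sum_{j\in I}x_j\beta^j : I\subset\mathbb{Z}\text{ finite},\ x_j\in\mathcal{A}\}$. For finite alphabets $\mathcal{A},\mathcal{B}$, a map $\varphi:\mathcal{A}^{\mathbb{Z}}\to\mathcal{B}^{\mathbb{Z}}$ is $p$-local if there are integers $r,t\geqslant 0$ with $p=r+t+1$ and a map $\Phi:\mathcal{A}^p\to\mathcal{B}$ such that for every $u=(u_j)$ and $v=\varphi(u)$ one has $v_j=\Phi(u_{j+t}\cdots u_j\cdots u_{j-r})$ for all $j\in\mathbb{Z}$. A digit set conversion in base $\beta$ from $\mathcal{A}$ to $\mathcal{B}$ (both containing $0$) is a map $\varphi:\mathcal{A}^{\mathbb{Z}}\to\mathcal{B}^{\mathbb{Z}}$ such that whenever $u$ has finitely many nonzero entries, $v=\varphi(u)$ has finitely many nonzero entries and $\sum_j v_j\beta^j=\sum_j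 u_j\beta^j$. An alphabet $\mathcal{A}$ allows parallel addition in base $\beta$ if there is a digit set conversion in base $\beta$ from $\mathcal{A}+\mathcal{A}=\{x+y:x,y\in\mathcal{A}\}$ to $\mathcal{A}$ that is $p$-local for some $p$. -}

module Defs where

open import Data.Nat as ℕ using (ℕ; zero; suc; _⊔_)
open import Data.Integer as ℤ using (ℤ; +_; _+_; _-_; _*_; -_; ∣_∣; _≤_; -[1+_])
open import Data.Fin using (Fin; toℕ)
open import Data.Product using (Σ; ∃; _×_; _,_; proj₁)
open import Relation.Binary.PropositionalEquality using (_≡_)

-- The ring ℤ[β] where β is a root of X² = aX − 1.
-- An element (x , y) stands for x + yβ.  For a ≥ 3 the polynomial
-- X² − aX + 1 is irreducible over ℚ, so this representation is exact:
-- equality in ℤ[β] ⊂ ℝ is equality of pairs.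

ZB : Set
ZB = ℤ × ℤ

zb0 : ZB
zb0 = (+ 0 , + 0)

_⊕_ : ZB → ZB → ZB
(x₁ , y₁) ⊕ (x₂ , y₂) = (x₁ + x₂ , y₁ + y₂)

-- (x₁ + y₁β)(x₂ + y₂β) = x₁x₂ − y₁y₂ + (x₁y₂ + x₂y₁ + a y₁y₂)β
mulB : ℕ → ZB → ZB → ZB
mulB a (x₁ , y₁) (x₂ , y₂) =
  (x₁ * x₂ - y₁ * y₂ , x₁ * y₂ + x₂ * y₁ + (+ a) * (y₁ * y₂))

emb : ℤ → ZB
emb x = (x , + 0)

βB : ZB
βB = (+ 0 , + 1)

-- β⁻¹ = a − β  (since β(a − β) = aβ − β² = 1)
βinv : ℕ → ZB
βinv a = (+ a , - (+ 1))

powN : ℕ → ZB → ℕ → ZB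
powN a x zero = (+ 1 , + 0)
powN a x (suc n) = mulB a x (powN a x n)

βpow : ℕ → ℤ → ZB
βpow a (+ n) = powN a βB n
βpow a -[1+ n ] = powN a (βinv a) (suc n)

sumUpTo : ℕ → (ℕ → ZB) → ZB
sumUpTo zero f = zb0
sumUpTo (suc n) f = sumUpTo n f ⊕ f n

Alphabet : Set₁
Alphabet = ℤ → Set

Digit : Alphabet → Set
Digit A = Σ ℤ A

_⊞_ : Alphabet → Alphabet → Alphabet
(A ⊞ B) z = ∃ λ x → ∃ λ y → A x × B y × z ≡ x + y

Icc : ℤ → ℤ → Alphabet
Icc m M x = m ≤ x × x ≤ M

Seq : Alphabet → Set
Seq A = ℤ → Digit A

FinSupp : {A : Alphabet} → ℕ → Seq A → Set
FinSupp N u = ∀ j → N ℕ.< ∣ j ∣ → proj₁ (u j) ≡ + 0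

val : {A : Alphabet} → ℕ → ℕ → Seq A → ZB
val a N u = sumUpTo (suc (N ℕ.+ N))
  (λ k → let j = (+ k) - (+ N) in mulB a (emb (proj₁ (u j))) (βpow a j))

-- p-local maps: v_j = Φ(u_{j+t} ⋯ u_j ⋯ u_{j−r}), p = r + t + 1.
-- The window is indexed by i ∈ Fin p, position i holding u_{j+t−i}.

IsLocal : (A B : Alphabet) → (Seq A → Seq B) → ℕ → Set
IsLocal A B φ p =
  Σ ℕ λ r → Σ ℕ λ t → (r ℕ.+ t ℕ.+ 1 ≡ p) ×
  Σ ((Fin p → Digit A) → Digit B) λ Φ →
    ∀ (u : Seq A) (j : ℤ) → φ u j ≡ Φ (λ i → u ((j + + t) - + (toℕ i)))

IsDigitConversion : ℕ → (A B : Alphabet) → (Seq A → Seq B) → Set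
IsDigitConversion a A B φ =
  ∀ (u : Seq A) (N : ℕ) → FinSupp N u →
    Σ ℕ λ M → FinSupp M (φ u) × val a (N ⊔ M) u ≡ val a (N ⊔ M) (φ u)

AllowsParallelAddition : ℕ → Alphabet → Set
AllowsParallelAddition a A =
  Σ ℕ λ p → Σ (Seq (A ⊞ A) → Seq A) λ φ →
    IsLocal (A ⊞ A) A φ p × IsDigitConversion a (A ⊞ A) A φ

-- Rewriting β² = aβ − 1 as β^(j−1) − aβ^j + β^(j+1) = 0 shows that replacing the digits x_j by
-- x_j − a Q_j + Q_(j−1) + Q_(j+1) preserves the value for every finitely supported carry sequence Q.
-- Two such rounds with carries in {0, 1}, each carry decided by the classes of a few neighbouring
-- digits, take A + A = {0, …, 2a − 2} into {0, …, a} and then into {0, …, a − 1}; that every window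
-- of classes lands in range is checked by enumeration.
--
-- Conversely, put M + 1 ∈ A + A at position 0 and convert into A = {m, …, M} with M − m + 1 < a.
-- The digit differences d_j satisfy Σ d_j β^j = 0, |d_j| ≤ a − 2 for j ≠ 0 and 1 ≤ |d_0| ≤ a − 1.
-- So X² − aX + 1 divides Σ d_j X^j, and the quotient coefficients, computed from either end, grow
-- strictly in absolute value towards position 0, where d_0 is too small to turn them around.

module Submission where

open import Defs
open import Data.Nat using (ℕ; _≤_)
open import Data.Integer using (ℤ; +_; _+_; _-_; _<_)
open import Data.Product using (Σ; _×_)
open import Relation.Nullary using (¬_)

open import Data.Nat as ℕ using (zero; suc; z≤n; s≤s)
import Data.Nat.Properties as ℕP
import Data.Nat.Tactic.RingSolver as ℕ-Solver
open import Data.Integer as ℤ using (-_; _*_; ∣_∣; -[1+_])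
import Data.Integer.Properties as ℤP
open import Data.Integer.Tactic.RingSolver using (solve-∀)
open import Data.Bool using (Bool; true; false; not; _∧_; _∨_; T)
open import Data.Bool.Properties using (T?)
open import Data.Fin using (Fin; toℕ; #_)
open import Data.Product using (_,_; proj₁; proj₂)
open import Data.Sum using (_⊎_; inj₁; inj₂)
open import Data.Empty using (⊥; ⊥-elim)
open import Relation.Binary.PropositionalEquality
open import Relation.Nullary using (Dec; yes; no)
open import Relation.Nullary.Decidable using (map′; _×-dec_; from-yes)

βpow₀ βpow₁ : ℕ → ℤ → ℤ
βpow₀ a j = proj₁ (βpow a j)
βpow₁ a j = proj₂ (βpow a j)

-- β (x + yβ) = −y + (x + ay)β; for negative exponents this is β (β⁻¹ (x + yβ)) = x + yβ.
private
  β-βinv₀ : ∀ A x y → x ≡ - (A * y + x * - + 1 + A * (- + 1 * y))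
  β-βinv₀ = solve-∀
  β-βinv₁ : ∀ A x y → y ≡ (A * x - - + 1 * y) + A * (A * y + x * - + 1 + A * (- + 1 * y))
  β-βinv₁ = solve-∀

βpow-suc : ∀ a j → βpow₀ a (ℤ.suc j) ≡ - βpow₁ a j × βpow₁ a (ℤ.suc j) ≡ βpow₀ a j + + a * βpow₁ a j
βpow-suc a (+ n) = times-β₀ (βpow₀ a (+ n)) (βpow₁ a (+ n)) , times-β₁ (+ a) (βpow₀ a (+ n)) (βpow₁ a (+ n))
  where
  times-β₀ : ∀ x y → + 0 * x - + 1 * y ≡ - y
  times-β₀ = solve-∀
  times-β₁ : ∀ A x y → + 0 * y + x * + 1 + A * (+ 1 * y) ≡ x + A * y
  times-β₁ = solve-∀
βpow-suc a -[1+ zero ] = β-βinv₀ (+ a) (+ 1) (+ 0) , β-βinv₁ (+ a) (+ 1) (+ 0)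
βpow-suc a -[1+ suc n ] =
  β-βinv₀ (+ a) (βpow₀ a -[1+ n ]) (βpow₁ a -[1+ n ]) , β-βinv₁ (+ a) (βpow₀ a -[1+ n ]) (βpow₁ a -[1+ n ])

Recurrent : ℤ → (ℤ → ℤ) → Set
Recurrent A C = ∀ j → C j + C (ℤ.suc (ℤ.suc j)) ≡ A * C (ℤ.suc j)

βpow₀-recurrent : ∀ a → Recurrent (+ a) (βpow₀ a)
βpow₀-recurrent a j
  rewrite proj₁ (βpow-suc a (ℤ.suc j)) | proj₂ (βpow-suc a j) | proj₁ (βpow-suc a j) =
  recurrence (+ a) (βpow₀ a j) (βpow₁ a j)
  where
  recurrence : ∀ A x y → x + - (x + A * y) ≡ A * - y
  recurrence = solve-∀

βpow₁-recurrent : ∀ a → Recurrent (+ a) (βpow₁ a)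
βpow₁-recurrent a j
  rewrite proj₂ (βpow-suc a (ℤ.suc j)) | proj₁ (βpow-suc a j) =
  recurrence (+ a) (βpow₁ a j) (βpow₁ a (ℤ.suc j))
  where
  recurrence : ∀ A y y′ → y + (- y + A * y′) ≡ A * y′
  recurrence = solve-∀

norm : ℕ → ℤ → ℤ → ℤ
norm a x y = x * x + + a * x * y + y * y

norm-βpow-suc : ∀ a j → norm a (βpow₀ a (ℤ.suc j)) (βpow₁ a (ℤ.suc j)) ≡ norm a (βpow₀ a j) (βpow₁ a j)
norm-βpow-suc a j rewrite proj₁ (βpow-suc a j) | proj₂ (βpow-suc a j) = invariant (+ a) (βpow₀ a j) (βpow₁ a j)
  where
  invariant : ∀ A x y → - y * - y + A * - y * (x + A * y) + (x + A * y) * (x + A * y) ≡ x * x + A * x * y + y * y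
  invariant = solve-∀

norm-βpow : ∀ a j → norm a (βpow₀ a j) (βpow₁ a j) ≡ + 1
norm-βpow a (+ zero) = unit (+ a)
  where
  unit : ∀ A → + 1 * + 1 + A * + 1 * + 0 + + 0 * + 0 ≡ + 1
  unit = solve-∀
norm-βpow a (+ suc n) = trans (norm-βpow-suc a (+ n)) (norm-βpow a (+ n))
norm-βpow a -[1+ zero ] = trans (sym (norm-βpow-suc a -[1+ zero ])) (norm-βpow a (+ 0))
norm-βpow a -[1+ suc n ] = trans (sym (norm-βpow-suc a -[1+ suc n ])) (norm-βpow a -[1+ n ])

-- Both identities are Cramer's rule: the determinant of (β^j, β^(j+1)) is the norm of β^j.
βpow-independent : ∀ a j p q → p * βpow₀ a j ≡ q * βpow₀ a (ℤ.suc j) → p * βpow₁ a j ≡ q * βpow₁ a (ℤ.suc j) →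
                   p ≡ + 0 × q ≡ + 0
βpow-independent a j p q e₀ e₁ = p≡0 , q≡0
  where
  open ≡-Reasoning
  x = βpow₀ a j
  y = βpow₁ a j
  e₀′ : p * x ≡ q * - y
  e₀′ = trans e₀ (cong (q *_) (proj₁ (βpow-suc a j)))
  e₁′ : p * y ≡ q * (x + + a * y)
  e₁′ = trans e₁ (cong (q *_) (proj₂ (βpow-suc a j)))
  cramer-q : ∀ A x y q → q * (x * x + A * x * y + y * y) ≡ x * (q * (x + A * y)) + q * - y * - y
  cramer-q = solve-∀
  cramer-p : ∀ A x y p → p * (x * x + A * x * y + y * y) ≡ x * (p * x) + (A * x + y) * (p * y)
  cramer-p = solve-∀
  cancel : ∀ x y p → x * (p * y) + p * x * - y ≡ + 0
  cancel = solve-∀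
  vanish : ∀ A x y → x * (+ 0 * - y) + (A * x + y) * (+ 0 * (x + A * y)) ≡ + 0
  vanish = solve-∀
  q≡0 : q ≡ + 0
  q≡0 = begin
    q                                   ≡⟨ sym (ℤP.*-identityʳ q) ⟩
    q * + 1                             ≡⟨ cong (q *_) (sym (norm-βpow a j)) ⟩
    q * norm a x y                      ≡⟨ cramer-q (+ a) x y q ⟩
    x * (q * (x + + a * y)) + q * - y * - y ≡⟨ cong₂ (λ s t → x * s + t * - y) (sym e₁′) (sym e₀′) ⟩
    x * (p * y) + p * x * - y           ≡⟨ cancel x y p ⟩
    + 0                                 ∎
  p≡0 : p ≡ + 0
  p≡0 = begin
    p                                   ≡⟨ sym (ℤP.*-identityʳ p) ⟩
    p * + 1                             ≡⟨ cong (p *_) (sym (norm-βpow a j)) ⟩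
    p * norm a x y                      ≡⟨ cramer-p (+ a) x y p ⟩
    x * (p * x) + (+ a * x + y) * (p * y) ≡⟨ cong₂ (λ s t → x * s + (+ a * x + y) * t) e₀′ e₁′ ⟩
    x * (q * - y) + (+ a * x + y) * (q * (x + + a * y)) ≡⟨ cong (λ r → x * (r * - y) + (+ a * x + y) * (r * (x + + a * y))) q≡0 ⟩
    x * (+ 0 * - y) + (+ a * x + y) * (+ 0 * (x + + a * y)) ≡⟨ vanish (+ a) x y ⟩
    + 0                                 ∎

∑ : ℕ → (ℕ → ℤ) → ℤ
∑ zero f = + 0
∑ (suc n) f = ∑ n f + f n

∑-cong : ∀ n {f g : ℕ → ℤ} → (∀ k → f k ≡ g k) → ∑ n f ≡ ∑ n g
∑-cong zero f≡g = refl
∑-cong (suc n) f≡g = cong₂ _+_ (∑-cong n f≡g) (f≡g n)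

∑-+ : ∀ n (f g : ℕ → ℤ) → ∑ n (λ k → f k + g k) ≡ ∑ n f + ∑ n g
∑-+ zero f g = refl
∑-+ (suc n) f g = trans (cong (_+ (f n + g n)) (∑-+ n f g)) (interchange (∑ n f) (∑ n g) (f n) (g n))
  where
  interchange : ∀ a b c d → a + b + (c + d) ≡ a + c + (b + d)
  interchange = solve-∀

∑-- : ∀ n (f g : ℕ → ℤ) → ∑ n (λ k → f k - g k) ≡ ∑ n f - ∑ n g
∑-- zero f g = refl
∑-- (suc n) f g = trans (cong (_+ (f n - g n)) (∑-- n f g)) (interchange (∑ n f) (∑ n g) (f n) (g n))
  where
  interchange : ∀ a b c d → a - b + (c - d) ≡ a + c - (b + d)
  interchange = solve-∀

∑-telescope : ∀ n (F : ℕ → ℤ) → ∑ n (λ k → F (suc k) - F k) ≡ F n - F 0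
∑-telescope zero F = sym (ℤP.+-inverseʳ (F 0))
∑-telescope (suc n) F = trans (cong (_+ (F (suc n) - F n)) (∑-telescope n F)) (collapse (F 0) (F n) (F (suc n)))
  where
  collapse : ∀ a b c → b - a + (c - b) ≡ c - a
  collapse = solve-∀

Δ² : ℤ → (ℕ → ℤ) → ℕ → ℤ
Δ² A P k = P k + P (suc (suc k)) - A * P (suc k)

casoratian : (ℕ → ℤ) → (ℕ → ℤ) → ℕ → ℤ
casoratian P c k = P (suc k) * c k - P k * c (suc k)

∑-by-parts : ∀ A (c : ℕ → ℤ) → (∀ k → c k + c (suc (suc k)) ≡ A * c (suc k)) → ∀ n P →
             ∑ n (λ k → Δ² A P k * c (suc k)) ≡ casoratian P c n - casoratian P c 0
∑-by-parts A c recurrence n P = trans (∑-cong n step) (∑-telescope n (casoratian P c))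
  where
  step : ∀ k → Δ² A P k * c (suc k) ≡ casoratian P c (suc k) - casoratian P c k
  step k = begin
    Δ² A P k * c (suc k)                                        ≡⟨ expand A (P k) (P (suc k)) (P (suc (suc k))) (c k) (c (suc k)) ⟩
    P (suc (suc k)) * c (suc k) - P (suc k) * (A * c (suc k) - c k) - (P (suc k) * c k - P k * c (suc k))
        ≡⟨ cong (λ t → P (suc (suc k)) * c (suc k) - P (suc k) * t - casoratian P c k) (sym (difference (recurrence k))) ⟩
    casoratian P c (suc k) - casoratian P c k                   ∎
    where
    open ≡-Reasoning
    expand : ∀ A p₀ p₁ p₂ c₀ c₁ → (p₀ + p₂ - A * p₁) * c₁ ≡ p₂ * c₁ - p₁ * (A * c₁ - c₀) - (p₁ * c₀ - p₀ * c₁)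
    expand = solve-∀
    difference : ∀ {x y z} → x + y ≡ z → y ≡ z - x
    difference {x} {y} refl = shuffle x y
      where
      shuffle : ∀ x y → y ≡ x + y - x
      shuffle = solve-∀

casoratian-vanishing : ∀ P c n → P (suc n) ≡ + 0 → P n ≡ + 0 → casoratian P c n ≡ + 0
casoratian-vanishing P c n p₁ p₀ rewrite p₁ | p₀ = refl

-- the position of the k-th summand in  val a K
pos : ℕ → ℕ → ℤ
pos K k = + k - + K

pos-suc : ∀ L k → pos L (suc k) ≡ ℤ.suc (pos L k)
pos-suc L k = shift (+ k) (+ L)
  where
  shift : ∀ k L → + 1 + k - L ≡ + 1 + (k - L)
  shift = solve-∀

pos-suc-suc : ∀ K k → pos (suc K) (suc k) ≡ pos K k
pos-suc-suc K k = shift (+ k) (+ K)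
  where
  shift : ∀ k K → + 1 + k - (+ 1 + K) ≡ k - K
  shift = solve-∀

recurrent-along : ∀ A C → Recurrent A C → ∀ L k → C (pos L k) + C (pos L (suc (suc k))) ≡ A * C (pos L (suc k))
recurrent-along A C recurrence L k rewrite pos-suc L (suc k) | pos-suc L k = recurrence (pos L k)

digits : {A : Alphabet} → Seq A → ℤ → ℤ
digits s j = proj₁ (s j)

coordSum : (ℤ → ℤ) → ℕ → (ℤ → ℤ) → ℤ
coordSum C K x = ∑ (suc (K ℕ.+ K)) (λ k → x (pos K k) * C (pos K k))

sumUpTo-coordinates : ∀ n (h : ℕ → ZB) → sumUpTo n h ≡ (∑ n (λ k → proj₁ (h k)) , ∑ n (λ k → proj₂ (h k)))
sumUpTo-coordinates zero h = refl
sumUpTo-coordinates (suc n) h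
  rewrite sumUpTo-coordinates n h = refl

val-coordinates : ∀ a K {A} (s : Seq A) → val a K s ≡ (coordSum (βpow₀ a) K (digits s) , coordSum (βpow₁ a) K (digits s))
val-coordinates a K s =
  trans (sumUpTo-coordinates (suc (K ℕ.+ K)) _)
        (cong₂ _,_ (∑-cong (suc (K ℕ.+ K)) λ k → scale₀ (digits s (pos K k)) (βpow₀ a (pos K k)) (βpow₁ a (pos K k)))
                   (∑-cong (suc (K ℕ.+ K)) λ k → scale₁ (+ a) (digits s (pos K k)) (βpow₀ a (pos K k)) (βpow₁ a (pos K k))))
  where
  scale₀ : ∀ e x y → e * x - + 0 * y ≡ e * x
  scale₀ = solve-∀
  scale₁ : ∀ A e x y → e * y + x * + 0 + A * (+ 0 * y) ≡ e * y
  scale₁ = solve-∀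

coordSum-difference : ∀ C K x y → coordSum C K x ≡ coordSum C K y →
                      ∑ (suc (K ℕ.+ K)) (λ k → (y (pos K k) - x (pos K k)) * C (pos K k)) ≡ + 0
coordSum-difference C K x y same = begin
  ∑ n (λ k → (y (pos K k) - x (pos K k)) * C (pos K k))  ≡⟨ ∑-cong n (λ k → distrib (y (pos K k)) (x (pos K k)) (C (pos K k))) ⟩
  ∑ n (λ k → y (pos K k) * C (pos K k) - x (pos K k) * C (pos K k)) ≡⟨ ∑-- n _ _ ⟩
  coordSum C K y - coordSum C K x                          ≡⟨ cong (_- coordSum C K x) (sym same) ⟩
  coordSum C K x - coordSum C K x                          ≡⟨ ℤP.+-inverseʳ (coordSum C K x) ⟩
  + 0                                                      ∎
  where
  open ≡-Reasoning
  n = suc (K ℕ.+ K)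
  distrib : ∀ y x c → (y - x) * c ≡ y * c - x * c
  distrib = solve-∀

Δ²ᶻ : ℤ → (ℤ → ℤ) → ℤ → ℤ
Δ²ᶻ A Q j = Q (j - + 1) + Q (j + + 1) - A * Q j

Δ²ᶻ-along : ∀ A Q K k → Δ²ᶻ A Q (pos K k) ≡ Δ² A (λ i → Q (pos (suc K) i)) k
Δ²ᶻ-along A Q K k = cong₃ (λ l r m → Q l + Q r - A * Q m) (left (+ k) (+ K)) (right (+ k) (+ K)) (sym (pos-suc-suc K k))
  where
  cong₃ : ∀ (f : ℤ → ℤ → ℤ → ℤ) {x x′ y y′ z z′} → x ≡ x′ → y ≡ y′ → z ≡ z′ → f x y z ≡ f x′ y′ z′
  cong₃ f refl refl refl = refl
  left : ∀ k K → k - K - + 1 ≡ k - (+ 1 + K)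
  left = solve-∀
  right : ∀ k K → k - K + + 1 ≡ + 1 + (+ 1 + k) - (+ 1 + K)
  right = solve-∀

∑-Δ²ᶻ-vanishing : ∀ A C → Recurrent A C → ∀ K Q → (∀ j → K ≤ ∣ j ∣ → Q j ≡ + 0) →
                  ∑ (suc (K ℕ.+ K)) (λ k → Δ²ᶻ A Q (pos K k) * C (pos K k)) ≡ + 0
∑-Δ²ᶻ-vanishing A C recurrence K Q vanish = begin
  ∑ n (λ k → Δ²ᶻ A Q (pos K k) * C (pos K k))
    ≡⟨ ∑-cong n (λ k → cong₂ _*_ (Δ²ᶻ-along A Q K k) (cong C (sym (pos-suc-suc K k)))) ⟩
  ∑ n (λ k → Δ² A P k * c (suc k))              ≡⟨ ∑-by-parts A c (recurrent-along A C recurrence (suc K)) n P ⟩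
  casoratian P c n - casoratian P c 0
    ≡⟨ cong₂ _-_ (casoratian-vanishing P c n top₁ top₀) (casoratian-vanishing P c 0 bottom₁ bottom₀) ⟩
  + 0                                           ∎
  where
  open ≡-Reasoning
  n = suc (K ℕ.+ K)
  P c : ℕ → ℤ
  P i = Q (pos (suc K) i)
  c i = C (pos (suc K) i)
  vanish-at : ∀ {j} i → pos (suc K) i ≡ j → K ≤ ∣ j ∣ → P i ≡ + 0
  vanish-at i refl = vanish (pos (suc K) i)
  top₁ : P (suc n) ≡ + 0
  top₁ = vanish-at (suc n) (edge (+ K)) (ℕP.n≤1+n K)
    where
    edge : ∀ K → + 1 + (+ 1 + (K + K)) - (+ 1 + K) ≡ + 1 + K
    edge = solve-∀
  top₀ : P n ≡ + 0
  top₀ = vanish-at n (edge (+ K)) ℕP.≤-refl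
    where
    edge : ∀ K → + 1 + (K + K) - (+ 1 + K) ≡ K
    edge = solve-∀
  bottom₁ : P 1 ≡ + 0
  bottom₁ = vanish-at 1 (edge (+ K)) (ℕP.≤-reflexive (sym (ℤP.∣-i∣≡∣i∣ (+ K))))
    where
    edge : ∀ K → + 1 - (+ 1 + K) ≡ - K
    edge = solve-∀
  bottom₀ : P 0 ≡ + 0
  bottom₀ = vanish (pos (suc K) 0) (ℕP.n≤1+n K)

coordSum-Δ²ᶻ : ∀ A C → Recurrent A C → ∀ K Q → (∀ j → K ≤ ∣ j ∣ → Q j ≡ + 0) →
               ∀ x y → (∀ j → y j ≡ x j + Δ²ᶻ A Q j) → coordSum C K y ≡ coordSum C K x
coordSum-Δ²ᶻ A C recurrence K Q vanish x y y≡x+Δ²Q = begin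
  ∑ n (λ k → y (pos K k) * C (pos K k))                                    ≡⟨ ∑-cong n split ⟩
  ∑ n (λ k → x (pos K k) * C (pos K k) + Δ²ᶻ A Q (pos K k) * C (pos K k))  ≡⟨ ∑-+ n _ _ ⟩
  coordSum C K x + ∑ n (λ k → Δ²ᶻ A Q (pos K k) * C (pos K k))
    ≡⟨ cong (λ t → coordSum C K x + t) (∑-Δ²ᶻ-vanishing A C recurrence K Q vanish) ⟩
  coordSum C K x + + 0                                                     ≡⟨ ℤP.+-identityʳ _ ⟩
  coordSum C K x                                                           ∎
  where
  open ≡-Reasoning
  n = suc (K ℕ.+ K)
  split : ∀ k → y (pos K k) * C (pos K k) ≡ x (pos K k) * C (pos K k) + Δ²ᶻ A Q (pos K k) * C (pos K k)
  split k = trans (cong (_* C (pos K k)) (y≡x+Δ²Q (pos K k)))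
                  (ℤP.*-distribʳ-+ (C (pos K k)) (x (pos K k)) (Δ²ᶻ A Q (pos K k)))


bit : Bool → ℕ
bit false = 0
bit true = 1

bits≤2 : ∀ l r → bit l ℕ.+ bit r ≤ 2
bits≤2 false false = z≤n
bits≤2 false true = s≤s z≤n
bits≤2 true false = s≤s z≤n
bits≤2 true true = ℕP.≤-refl

data Class₁ : Set where
  ≤a-2 =a-1 ≥a : Class₁

data Class₂ : Set where
  ≤a-3 =a-2 =a-1 =a : Class₂

all-Class₁? : {P : Class₁ → Set} → (∀ c → Dec (P c)) → Dec (∀ c → P c)
all-Class₁? P? = map′ (λ { (p , q , r) → λ { ≤a-2 → p ; =a-1 → q ; ≥a → r } })
                     (λ p → p ≤a-2 , p =a-1 , p ≥a)
                     (P? ≤a-2 ×-dec P? =a-1 ×-dec P? ≥a)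

all-Class₂? : {P : Class₂ → Set} → (∀ c → Dec (P c)) → Dec (∀ c → P c)
all-Class₂? P? = map′ (λ { (p , q , r , s) → λ { ≤a-3 → p ; =a-2 → q ; =a-1 → r ; =a → s } })
                     (λ p → p ≤a-3 , p =a-2 , p =a-1 , p =a)
                     (P? ≤a-3 ×-dec P? =a-2 ×-dec P? =a-1 ×-dec P? =a)

rule₁ : Class₁ → Class₁ → Class₁ → Bool
rule₁ _ ≥a _ = true
rule₁ ≥a =a-1 ≥a = true
rule₁ _ _ _ = false

-- whether x − a q + s lands in [0, a] for every x of the given class
admissible₁ : Class₁ → Bool → ℕ → Bool
admissible₁ ≤a-2 q s = not q
admissible₁ =a-1 false s = s ℕ.≤ᵇ 1
admissible₁ =a-1 true s = 1 ℕ.≤ᵇ s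
admissible₁ ≥a q s = q

rule₁-admissible : ∀ c₋₂ c₋₁ c₀ c₁ c₂ →
  T (admissible₁ c₀ (rule₁ c₋₁ c₀ c₁) (bit (rule₁ c₋₂ c₋₁ c₀) ℕ.+ bit (rule₁ c₀ c₁ c₂)))
rule₁-admissible = from-yes (all-Class₁? λ c₋₂ → all-Class₁? λ c₋₁ → all-Class₁? λ c₀ → all-Class₁? λ c₁ → all-Class₁? λ c₂ →
  T? (admissible₁ c₀ (rule₁ c₋₁ c₀ c₁) (bit (rule₁ c₋₂ c₋₁ c₀) ℕ.+ bit (rule₁ c₀ c₁ c₂))))

is=a is=a-1 is≥a-1 is≤a-3 : Class₂ → Bool
is=a =a = true
is=a _ = false
is=a-1 =a-1 = true
is=a-1 _ = false
is≥a-1 c = is=a c ∨ is=a-1 c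
is≤a-3 ≤a-3 = true
is≤a-3 _ = false

rule₂ : Class₂ → Class₂ → Class₂ → Class₂ → Class₂ → Bool
rule₂ c₋₂ c₋₁ ≤a-3 c₁ c₂ = false
rule₂ c₋₂ c₋₁ =a-2 c₁ c₂ = (is=a c₋₁ ∨ (is=a-1 c₋₁ ∧ is≥a-1 c₋₂)) ∧ (is=a c₁ ∨ (is=a-1 c₁ ∧ is≥a-1 c₂))
rule₂ c₋₂ c₋₁ =a-1 c₁ c₂ = is=a c₋₁ ∨ is=a c₁ ∨ (is=a-1 c₋₁ ∧ not (is≤a-3 c₋₂ ∧ is≤a-3 c₁))
                                          ∨ (is=a-1 c₁ ∧ not (is≤a-3 c₋₁ ∧ is≤a-3 c₂))
rule₂ c₋₂ c₋₁ =a c₁ c₂ = true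

-- whether z − a q + s lands in [0, a − 1] for every z of the given class
admissible₂ : Class₂ → Bool → ℕ → Bool
admissible₂ ≤a-3 q s = not q
admissible₂ =a-2 false s = s ℕ.≤ᵇ 1
admissible₂ =a-2 true s = 2 ℕ.≤ᵇ s
admissible₂ =a-1 false s = s ℕ.≤ᵇ 0
admissible₂ =a-1 true s = 1 ℕ.≤ᵇ s
admissible₂ =a q s = q

rule₂-admissible : ∀ c₋₃ c₋₂ c₋₁ c₀ c₁ c₂ c₃ →
  T (admissible₂ c₀ (rule₂ c₋₂ c₋₁ c₀ c₁ c₂) (bit (rule₂ c₋₃ c₋₂ c₋₁ c₀ c₁) ℕ.+ bit (rule₂ c₋₁ c₀ c₁ c₂ c₃)))
rule₂-admissible = from-yes (all-Class₂? λ c₋₃ → all-Class₂? λ c₋₂ → all-Class₂? λ c₋₁ → all-Class₂? λ c₀ →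
  all-Class₂? λ c₁ → all-Class₂? λ c₂ → all-Class₂? λ c₃ →
  T? (admissible₂ c₀ (rule₂ c₋₂ c₋₁ c₀ c₁ c₂) (bit (rule₂ c₋₃ c₋₂ c₋₁ c₀ c₁) ℕ.+ bit (rule₂ c₋₁ c₀ c₁ c₂ c₃))))

∣j∣≤∣j+c∣+∣c∣ : ∀ j c → ∣ j ∣ ≤ ∣ j + c ∣ ℕ.+ ∣ c ∣
∣j∣≤∣j+c∣+∣c∣ j c = subst (λ i → ∣ i ∣ ≤ ∣ j + c ∣ ℕ.+ ∣ c ∣) (cancel j c) (ℤP.∣i-j∣≤∣i∣+∣j∣ (j + c) c)
  where
  cancel : ∀ j c → j + c - c ≡ j
  cancel = solve-∀

far : ∀ {n r} j c → n ℕ.+ r ℕ.< ∣ j ∣ → ∣ c ∣ ≤ r → n ℕ.< ∣ j + c ∣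
far {n} {r} j c n+r<∣j∣ ∣c∣≤r =
  ℕP.+-cancelʳ-< r n ∣ j + c ∣ (ℕP.<-≤-trans n+r<∣j∣ (ℕP.≤-trans (∣j∣≤∣j+c∣+∣c∣ j c) (ℕP.+-monoʳ-≤ ∣ j + c ∣ ∣c∣≤r)))

CanonicalAlphabet : ℕ → Alphabet
CanonicalAlphabet a = Icc (+ 0) (+ a - + 1)

module Construction (a′ : ℕ) where

  a : ℕ
  a = suc (suc (suc a′))

  -- incoming carries s, outgoing carry q
  settle : ℤ → Bool → ℕ → ℤ
  settle x q s = + s + x - + bit q * + a

  settle-false : ∀ x s → settle x false s ≡ + s + x
  settle-false x s = ℤP.+-identityʳ (+ s + x)

  settle-true : ∀ x s k → + s + x ≡ + k + + a → settle x true s ≡ + k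
  settle-true x s k balance = begin
    + s + x - + 1 * + a    ≡⟨ cong (λ t → + s + x - t) (ℤP.*-identityˡ (+ a)) ⟩
    + s + x - + a          ≡⟨ cong (_- + a) balance ⟩
    + k + + a - + a        ≡⟨ cancel (+ k) (+ a) ⟩
    + k                    ∎
    where
    open ≡-Reasoning
    cancel : ∀ k A → k + A - A ≡ k
    cancel = solve-∀

  classify₁ : ℤ → Class₁
  classify₁ x with x ℤ.≤? + suc a′
  ... | yes _ = ≤a-2
  ... | no _ with x ℤ.≤? + suc (suc a′)
  ...   | yes _ = =a-1
  ...   | no _ = ≥a

  InClass₁ : Class₁ → ℤ → Set
  InClass₁ ≤a-2 x = Σ ℕ λ n → x ≡ + n × n ≤ suc a′
  InClass₁ =a-1 x = x ≡ + suc (suc a′)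
  InClass₁ ≥a x = Σ ℕ λ n → x ≡ + (n ℕ.+ a) × n ≤ suc a′

  classify₁-sound : ∀ x → + 0 ℤ.≤ x → x ℤ.≤ + (suc (suc a′) ℕ.+ suc (suc a′)) → InClass₁ (classify₁ x) x
  classify₁-sound (+ n) _ (ℤ.+≤+ n≤2a-2) with + n ℤ.≤? + suc a′
  ... | yes (ℤ.+≤+ n≤a-2) = n , refl , n≤a-2
  ... | no n≰a-2 with + n ℤ.≤? + suc (suc a′)
  ...   | yes (ℤ.+≤+ n≤a-1) = cong +_ (ℕP.≤-antisym n≤a-1 (ℕP.≰⇒> (λ n≤a-2 → n≰a-2 (ℤ.+≤+ n≤a-2))))
  ...   | no n≰a-1 = n ℕ.∸ a , cong +_ (sym (ℕP.m∸n+n≡m a≤n)) ,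
                     ℕP.+-cancelʳ-≤ a _ _ (subst₂ _≤_ (sym (ℕP.m∸n+n≡m a≤n)) (sym (cong suc (ℕP.+-suc a′ (suc (suc a′))))) n≤2a-2)
    where
    a≤n : a ≤ n
    a≤n = ℕP.≰⇒> (λ n≤a-1 → n≰a-1 (ℤ.+≤+ n≤a-1))

  Bounded : ℕ → ℤ → Set
  Bounded B z = Σ ℕ λ k → z ≡ + k × k ≤ B

  settle₁-bound : ∀ c x q s → InClass₁ c x → s ≤ 2 → T (admissible₁ c q s) → Bounded a (settle x q s)
  settle₁-bound ≤a-2 x false s (n , refl , n≤a-2) s≤2 _ = s ℕ.+ n , settle-false (+ n) s , ℕP.+-mono-≤ s≤2 n≤a-2
  settle₁-bound =a-1 x false s refl _ s≤1 = s ℕ.+ suc (suc a′) , settle-false x s , ℕP.+-monoˡ-≤ (suc (suc a′)) (ℕP.≤ᵇ⇒≤ s 1 s≤1)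
  settle₁-bound =a-1 x true 1 refl _ _ = 0 , settle-true x 1 0 refl , z≤n
  settle₁-bound =a-1 x true 2 refl _ _ = 1 , settle-true x 2 1 refl , s≤s z≤n
  settle₁-bound =a-1 x true (suc (suc (suc _))) _ (s≤s (s≤s ())) _
  settle₁-bound ≥a x true s (n , refl , n≤a-2) s≤2 _ =
    s ℕ.+ n , settle-true x s (s ℕ.+ n) (cong +_ (sym (ℕP.+-assoc s n a))) , ℕP.+-mono-≤ s≤2 n≤a-2

  classify₂ : ℤ → Class₂
  classify₂ x with x ℤ.≤? + a′
  ... | yes _ = ≤a-3
  ... | no _ with x ℤ.≤? + suc a′
  ...   | yes _ = =a-2
  ...   | no _ with x ℤ.≤? + suc (suc a′)
  ...     | yes _ = =a-1
  ...     | no _ = =a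

  InClass₂ : Class₂ → ℤ → Set
  InClass₂ ≤a-3 x = Σ ℕ λ n → x ≡ + n × n ≤ a′
  InClass₂ =a-2 x = x ≡ + suc a′
  InClass₂ =a-1 x = x ≡ + suc (suc a′)
  InClass₂ =a x = x ≡ + a

  classify₂-sound : ∀ {z} → Bounded a z → InClass₂ (classify₂ z) z
  classify₂-sound (n , refl , n≤a) with + n ℤ.≤? + a′
  ... | yes (ℤ.+≤+ n≤a-3) = n , refl , n≤a-3
  ... | no n≰a-3 with + n ℤ.≤? + suc a′
  ...   | yes (ℤ.+≤+ n≤a-2) = cong +_ (ℕP.≤-antisym n≤a-2 (ℕP.≰⇒> (λ n≤a-3 → n≰a-3 (ℤ.+≤+ n≤a-3))))
  ...   | no n≰a-2 with + n ℤ.≤? + suc (suc a′)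
  ...     | yes (ℤ.+≤+ n≤a-1) = cong +_ (ℕP.≤-antisym n≤a-1 (ℕP.≰⇒> (λ n≤a-2 → n≰a-2 (ℤ.+≤+ n≤a-2))))
  ...     | no n≰a-1 = cong +_ (ℕP.≤-antisym n≤a (ℕP.≰⇒> (λ n≤a-1 → n≰a-1 (ℤ.+≤+ n≤a-1))))

  settle₂-bound : ∀ c x q s → InClass₂ c x → s ≤ 2 → T (admissible₂ c q s) → Bounded (suc (suc a′)) (settle x q s)
  settle₂-bound ≤a-3 x false s (n , refl , n≤a-3) s≤2 _ = s ℕ.+ n , settle-false (+ n) s , ℕP.+-mono-≤ s≤2 n≤a-3
  settle₂-bound =a-2 x false 0 refl _ _ = suc a′ , settle-false x 0 , ℕP.n≤1+n _
  settle₂-bound =a-2 x false 1 refl _ _ = suc (suc a′) , settle-false x 1 , ℕP.≤-refl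
  settle₂-bound =a-2 x true 2 refl _ _ = 0 , settle-true x 2 0 refl , z≤n
  settle₂-bound =a-2 x true (suc (suc (suc _))) _ (s≤s (s≤s ())) _
  settle₂-bound =a-1 x false 0 refl _ _ = suc (suc a′) , settle-false x 0 , ℕP.≤-refl
  settle₂-bound =a-1 x true 1 refl _ _ = 0 , settle-true x 1 0 refl , z≤n
  settle₂-bound =a-1 x true 2 refl _ _ = 1 , settle-true x 2 1 refl , s≤s z≤n
  settle₂-bound =a-1 x true (suc (suc (suc _))) _ (s≤s (s≤s ())) _
  settle₂-bound =a x true s refl s≤2 _ = s , settle-true x s s refl , ℕP.≤-trans s≤2 (ℕP.m≤m+n 2 a′)

  carry₁ : ℤ → ℤ → ℤ → Bool
  carry₁ x₋₁ x₀ x₁ = rule₁ (classify₁ x₋₁) (classify₁ x₀) (classify₁ x₁)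

  round₁ : ℤ → ℤ → ℤ → ℤ → ℤ → ℤ
  round₁ x₋₂ x₋₁ x₀ x₁ x₂ = settle x₀ (carry₁ x₋₁ x₀ x₁) (bit (carry₁ x₋₂ x₋₁ x₀) ℕ.+ bit (carry₁ x₀ x₁ x₂))

  carry₂ : ℤ → ℤ → ℤ → ℤ → ℤ → Bool
  carry₂ z₋₂ z₋₁ z₀ z₁ z₂ = rule₂ (classify₂ z₋₂) (classify₂ z₋₁) (classify₂ z₀) (classify₂ z₁) (classify₂ z₂)

  round₂ : ℤ → ℤ → ℤ → ℤ → ℤ → ℤ → ℤ → ℤ
  round₂ z₋₃ z₋₂ z₋₁ z₀ z₁ z₂ z₃ =
    settle z₀ (carry₂ z₋₂ z₋₁ z₀ z₁ z₂) (bit (carry₂ z₋₃ z₋₂ z₋₁ z₀ z₁) ℕ.+ bit (carry₂ z₋₁ z₀ z₁ z₂ z₃))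

  InSum : ℤ → Set
  InSum x = + 0 ℤ.≤ x × x ℤ.≤ + (suc (suc a′) ℕ.+ suc (suc a′))

  round₁-bound : ∀ {x₋₂ x₋₁ x₀ x₁ x₂} → InSum x₋₂ → InSum x₋₁ → InSum x₀ → InSum x₁ → InSum x₂ →
                 Bounded a (round₁ x₋₂ x₋₁ x₀ x₁ x₂)
  round₁-bound {x₋₂} {x₋₁} {x₀} {x₁} {x₂} _ _ (0≤x₀ , x₀≤2a-2) _ _ =
    settle₁-bound (classify₁ x₀) x₀ _ _ (classify₁-sound x₀ 0≤x₀ x₀≤2a-2) (bits≤2 (carry₁ x₋₂ x₋₁ x₀) (carry₁ x₀ x₁ x₂))
      (rule₁-admissible (classify₁ x₋₂) (classify₁ x₋₁) (classify₁ x₀) (classify₁ x₁) (classify₁ x₂))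

  round₂-bound : ∀ z₋₃ z₋₂ z₋₁ {z₀} z₁ z₂ z₃ → Bounded a z₀ → Bounded (suc (suc a′)) (round₂ z₋₃ z₋₂ z₋₁ z₀ z₁ z₂ z₃)
  round₂-bound z₋₃ z₋₂ z₋₁ {z₀} z₁ z₂ z₃ z₀≤a =
    settle₂-bound (classify₂ z₀) z₀ _ _ (classify₂-sound z₀≤a) (bits≤2 (carry₂ z₋₃ z₋₂ z₋₁ z₀ z₁) (carry₂ z₋₁ z₀ z₁ z₂ z₃))
      (rule₂-admissible (classify₂ z₋₃) (classify₂ z₋₂) (classify₂ z₋₁) (classify₂ z₀) (classify₂ z₁) (classify₂ z₂) (classify₂ z₃))

  carry : ℤ → ℤ → ℤ → ℤ → ℤ → ℤ → ℤ → ℤ → ℤ → ℤ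
  carry x₋₄ x₋₃ x₋₂ x₋₁ x₀ x₁ x₂ x₃ x₄ =
    + bit (carry₁ x₋₁ x₀ x₁) +
    + bit (carry₂ (round₁ x₋₄ x₋₃ x₋₂ x₋₁ x₀) (round₁ x₋₃ x₋₂ x₋₁ x₀ x₁) (round₁ x₋₂ x₋₁ x₀ x₁ x₂)
                  (round₁ x₋₁ x₀ x₁ x₂ x₃) (round₁ x₀ x₁ x₂ x₃ x₄))

  convert : ℤ → ℤ → ℤ → ℤ → ℤ → ℤ → ℤ → ℤ → ℤ → ℤ → ℤ → ℤ
  convert x₋₅ x₋₄ x₋₃ x₋₂ x₋₁ x₀ x₁ x₂ x₃ x₄ x₅ =
    round₂ (round₁ x₋₅ x₋₄ x₋₃ x₋₂ x₋₁) (round₁ x₋₄ x₋₃ x₋₂ x₋₁ x₀) (round₁ x₋₃ x₋₂ x₋₁ x₀ x₁)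
           (round₁ x₋₂ x₋₁ x₀ x₁ x₂)
           (round₁ x₋₁ x₀ x₁ x₂ x₃) (round₁ x₀ x₁ x₂ x₃ x₄) (round₁ x₁ x₂ x₃ x₄ x₅)

  convert-bound : ∀ x₋₅ x₋₄ x₋₃ x₋₂ x₋₁ x₀ x₁ x₂ x₃ x₄ x₅ → InSum x₋₂ → InSum x₋₁ → InSum x₀ → InSum x₁ → InSum x₂ →
                  Bounded (suc (suc a′)) (convert x₋₅ x₋₄ x₋₃ x₋₂ x₋₁ x₀ x₁ x₂ x₃ x₄ x₅)
  convert-bound x₋₅ x₋₄ x₋₃ x₋₂ x₋₁ x₀ x₁ x₂ x₃ x₄ x₅ ∈₋₂ ∈₋₁ ∈₀ ∈₁ ∈₂ =
    round₂-bound (round₁ x₋₅ x₋₄ x₋₃ x₋₂ x₋₁) (round₁ x₋₄ x₋₃ x₋₂ x₋₁ x₀) (round₁ x₋₃ x₋₂ x₋₁ x₀ x₁)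
                 (round₁ x₋₁ x₀ x₁ x₂ x₃) (round₁ x₀ x₁ x₂ x₃ x₄) (round₁ x₁ x₂ x₃ x₄ x₅)
                 (round₁-bound ∈₋₂ ∈₋₁ ∈₀ ∈₁ ∈₂)

  convert-carries : ∀ x₋₅ x₋₄ x₋₃ x₋₂ x₋₁ x₀ x₁ x₂ x₃ x₄ x₅ →
    convert x₋₅ x₋₄ x₋₃ x₋₂ x₋₁ x₀ x₁ x₂ x₃ x₄ x₅ ≡
    x₀ + (carry x₋₅ x₋₄ x₋₃ x₋₂ x₋₁ x₀ x₁ x₂ x₃ + carry x₋₃ x₋₂ x₋₁ x₀ x₁ x₂ x₃ x₄ x₅
          - + a * carry x₋₄ x₋₃ x₋₂ x₋₁ x₀ x₁ x₂ x₃ x₄)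
  convert-carries x₋₅ x₋₄ x₋₃ x₋₂ x₋₁ x₀ x₁ x₂ x₃ x₄ x₅ =
    two-rounds (+ a) x₀ (+ bit (carry₁ x₋₁ x₀ x₁)) (+ bit (carry₁ x₋₂ x₋₁ x₀)) (+ bit (carry₁ x₀ x₁ x₂))
               (+ bit q₀) (+ bit q₋) (+ bit q₊)
    where
    q₋ = carry₂ (round₁ x₋₅ x₋₄ x₋₃ x₋₂ x₋₁) (round₁ x₋₄ x₋₃ x₋₂ x₋₁ x₀) (round₁ x₋₃ x₋₂ x₋₁ x₀ x₁)
                (round₁ x₋₂ x₋₁ x₀ x₁ x₂) (round₁ x₋₁ x₀ x₁ x₂ x₃)
    q₀ = carry₂ (round₁ x₋₄ x₋₃ x₋₂ x₋₁ x₀) (round₁ x₋₃ x₋₂ x₋₁ x₀ x₁) (round₁ x₋₂ x₋₁ x₀ x₁ x₂)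
                (round₁ x₋₁ x₀ x₁ x₂ x₃) (round₁ x₀ x₁ x₂ x₃ x₄)
    q₊ = carry₂ (round₁ x₋₃ x₋₂ x₋₁ x₀ x₁) (round₁ x₋₂ x₋₁ x₀ x₁ x₂) (round₁ x₋₁ x₀ x₁ x₂ x₃)
                (round₁ x₀ x₁ x₂ x₃ x₄) (round₁ x₁ x₂ x₃ x₄ x₅)
    two-rounds : ∀ A x p p₋ p₊ q q₋ q₊ →
      q₋ + q₊ + (p₋ + p₊ + x - p * A) - q * A ≡ x + (p₋ + q₋ + (p₊ + q₊) - A * (p + q))
    two-rounds = solve-∀

  carry-cong : ∀ {x₋₄ x₋₃ x₋₂ x₋₁ x₀ x₁ x₂ x₃ x₄ y₋₄ y₋₃ y₋₂ y₋₁ y₀ y₁ y₂ y₃ y₄} →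
    x₋₄ ≡ y₋₄ → x₋₃ ≡ y₋₃ → x₋₂ ≡ y₋₂ → x₋₁ ≡ y₋₁ → x₀ ≡ y₀ → x₁ ≡ y₁ → x₂ ≡ y₂ → x₃ ≡ y₃ → x₄ ≡ y₄ →
    carry x₋₄ x₋₃ x₋₂ x₋₁ x₀ x₁ x₂ x₃ x₄ ≡ carry y₋₄ y₋₃ y₋₂ y₋₁ y₀ y₁ y₂ y₃ y₄
  carry-cong refl refl refl refl refl refl refl refl refl = refl

  convert-cong : ∀ {x₋₅ x₋₄ x₋₃ x₋₂ x₋₁ x₀ x₁ x₂ x₃ x₄ x₅ y₋₅ y₋₄ y₋₃ y₋₂ y₋₁ y₀ y₁ y₂ y₃ y₄ y₅} →
    x₋₅ ≡ y₋₅ → x₋₄ ≡ y₋₄ → x₋₃ ≡ y₋₃ → x₋₂ ≡ y₋₂ → x₋₁ ≡ y₋₁ → x₀ ≡ y₀ → x₁ ≡ y₁ → x₂ ≡ y₂ → x₃ ≡ y₃ → x₄ ≡ y₄ → x₅ ≡ y₅ →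
    convert x₋₅ x₋₄ x₋₃ x₋₂ x₋₁ x₀ x₁ x₂ x₃ x₄ x₅ ≡ convert y₋₅ y₋₄ y₋₃ y₋₂ y₋₁ y₀ y₁ y₂ y₃ y₄ y₅
  convert-cong refl refl refl refl refl refl refl refl refl refl refl = refl

  carryAt : (ℤ → ℤ) → ℤ → ℤ
  carryAt x j = carry (x (j + -[1+ 3 ])) (x (j + -[1+ 2 ])) (x (j + -[1+ 1 ])) (x (j + -[1+ 0 ])) (x (j + + 0))
                      (x (j + + 1)) (x (j + + 2)) (x (j + + 3)) (x (j + + 4))

  convertAt : (ℤ → ℤ) → ℤ → ℤ
  convertAt x j = convert (x (j + -[1+ 4 ])) (x (j + -[1+ 3 ])) (x (j + -[1+ 2 ])) (x (j + -[1+ 1 ])) (x (j + -[1+ 0 ]))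
                          (x (j + + 0)) (x (j + + 1)) (x (j + + 2)) (x (j + + 3)) (x (j + + 4)) (x (j + + 5))

  shift : ∀ (x : ℤ → ℤ) j {c d} → x (j + c + d) ≡ x (j + (c + d))
  shift x j {c} {d} = cong x (ℤP.+-assoc j c d)

  convertAt-Δ²ᶻ : ∀ x j → convertAt x j ≡ x j + Δ²ᶻ (+ a) (carryAt x) j
  convertAt-Δ²ᶻ x j = trans (convert-carries (at -[1+ 4 ]) (at -[1+ 3 ]) (at -[1+ 2 ]) (at -[1+ 1 ]) (at -[1+ 0 ])
                                              (at (+ 0)) (at (+ 1)) (at (+ 2)) (at (+ 3)) (at (+ 4)) (at (+ 5)))
    (cong₂ (λ x₀ Q → x₀ + (Q - + a * carryAt x j)) (cong x (ℤP.+-identityʳ j))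
      (cong₂ _+_ (sym (carry-cong (s) (s) (s) (s) (s) (s) (s) (s) (s)))
                 (sym (carry-cong (s) (s) (s) (s) (s) (s) (s) (s) (s)))))
    where
    at : ℤ → ℤ
    at c = x (j + c)
    s = shift x j

  A : Alphabet
  A = CanonicalAlphabet a

  inSum : (x : Digit (A ⊞ A)) → InSum (proj₁ x)
  inSum (_ , _ , _ , (0≤y , y≤a-1) , (0≤z , z≤a-1) , refl) = ℤP.+-mono-≤ 0≤y 0≤z , ℤP.+-mono-≤ y≤a-1 z≤a-1

  -- position i of the window holds u_{j+5−i}
  Φ : (Fin 11 → Digit (A ⊞ A)) → Digit A
  Φ w = convert (at (# 10)) (at (# 9)) (at (# 8)) (at (# 7)) (at (# 6)) (at (# 5))
                (at (# 4)) (at (# 3)) (at (# 2)) (at (# 1)) (at (# 0)) ,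
        subst A (sym (proj₁ (proj₂ bounded))) (ℤ.+≤+ z≤n , ℤ.+≤+ (proj₂ (proj₂ bounded)))
    where
    at : Fin 11 → ℤ
    at i = proj₁ (w i)
    bounded = convert-bound (at (# 10)) (at (# 9)) (at (# 8)) (at (# 7)) (at (# 6)) (at (# 5))
                            (at (# 4)) (at (# 3)) (at (# 2)) (at (# 1)) (at (# 0))
                (inSum (w (# 7))) (inSum (w (# 6))) (inSum (w (# 5))) (inSum (w (# 4))) (inSum (w (# 3)))

  φ : Seq (A ⊞ A) → Seq A
  φ u j = Φ (λ i → u ((j + + 5) - + toℕ i))

  φ-local : IsLocal (A ⊞ A) A φ 11
  φ-local = 5 , 5 , refl , Φ , λ u j → refl

  φ-digits : ∀ u j → digits (φ u) j ≡ convertAt (digits u) j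
  φ-digits u j = convert-cong s s s s s s s s s s s
    where
    s = shift (digits u) j

  module _ (u : Seq (A ⊞ A)) (N : ℕ) (finite : FinSupp N u) where

    private
      x = digits u

    carryAt-vanishing : ∀ j → N ℕ.+ 4 ℕ.< ∣ j ∣ → carryAt x j ≡ + 0
    carryAt-vanishing j N+4<∣j∣ =
      carry-cong (near -[1+ 3 ] _) (near -[1+ 2 ] _) (near -[1+ 1 ] _) (near -[1+ 0 ] _) (near (+ 0) _)
                 (near (+ 1) _) (near (+ 2) _) (near (+ 3) _) (near (+ 4) _)
      where
      near : ∀ c → T (∣ c ∣ ℕ.≤ᵇ 4) → x (j + c) ≡ + 0
      near c ∣c∣≤4 = finite (j + c) (far j c N+4<∣j∣ (ℕP.≤ᵇ⇒≤ ∣ c ∣ 4 ∣c∣≤4))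

    φ-finite : FinSupp (N ℕ.+ 5) (φ u)
    φ-finite j N+5<∣j∣ = begin
      digits (φ u) j                                                ≡⟨ trans (φ-digits u j) (convertAt-Δ²ᶻ x j) ⟩
      x j + (carryAt x (j - + 1) + carryAt x (j + + 1) - + a * carryAt x j)
        ≡⟨ cong₂ _+_ (finite j (ℕP.<-trans (ℕP.m<m+n N ℕ.z<s) N+5<∣j∣))
                     (cong₂ _-_ (cong₂ _+_ (carryAt-vanishing (j - + 1) (far j (- + 1) N+4+1<∣j∣ ℕP.≤-refl))
                                          (carryAt-vanishing (j + + 1) (far j (+ 1) N+4+1<∣j∣ ℕP.≤-refl)))
                                (trans (cong (+ a *_) (carryAt-vanishing j (ℕP.<-trans (ℕP.m<m+n _ ℕ.z<s) N+4+1<∣j∣)))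
                                       (ℤP.*-zeroʳ (+ a)))) ⟩
      + 0                                                           ∎
      where
      open ≡-Reasoning
      N+4+1<∣j∣ : N ℕ.+ 4 ℕ.+ 1 ℕ.< ∣ j ∣
      N+4+1<∣j∣ = subst (ℕ._< ∣ j ∣) (sym (ℕP.+-assoc N 4 1)) N+5<∣j∣

    φ-preserves-value : ∀ K → N ℕ.+ 5 ≤ K → val a K u ≡ val a K (φ u)
    φ-preserves-value K N+5≤K = begin
      val a K u                                                       ≡⟨ val-coordinates a K u ⟩
      (coordSum (βpow₀ a) K x , coordSum (βpow₁ a) K x)
        ≡⟨ cong₂ _,_ (same (βpow₀ a) (βpow₀-recurrent a)) (same (βpow₁ a) (βpow₁-recurrent a)) ⟩
      (coordSum (βpow₀ a) K (digits (φ u)) , coordSum (βpow₁ a) K (digits (φ u))) ≡⟨ val-coordinates a K (φ u) ⟨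
      val a K (φ u)                                                   ∎
      where
      open ≡-Reasoning
      same : ∀ C → Recurrent (+ a) C → coordSum C K x ≡ coordSum C K (digits (φ u))
      same C recurrence = sym (coordSum-Δ²ᶻ (+ a) C recurrence K (carryAt x)
        (λ j K≤∣j∣ → carryAt-vanishing j (ℕP.<-≤-trans (subst (ℕ._≤ K) (ℕP.+-suc N 4) N+5≤K) K≤∣j∣))
        x (digits (φ u)) (λ j → trans (φ-digits u j) (convertAt-Δ²ᶻ x j)))

  φ-conversion : IsDigitConversion a (A ⊞ A) A φ
  φ-conversion u N finite = N ℕ.+ 5 , φ-finite u N finite , φ-preserves-value u N finite (N ℕ.⊔ (N ℕ.+ 5)) (ℕP.m≤n⊔m N (N ℕ.+ 5))

parallel-addition : ∀ a → 3 ≤ a →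
  Σ (Seq (CanonicalAlphabet a ⊞ CanonicalAlphabet a) → Seq (CanonicalAlphabet a)) λ φ →
    IsLocal (CanonicalAlphabet a ⊞ CanonicalAlphabet a) (CanonicalAlphabet a) φ 11 ×
    IsDigitConversion a (CanonicalAlphabet a ⊞ CanonicalAlphabet a) (CanonicalAlphabet a) φ
parallel-addition (suc zero) (s≤s ())
parallel-addition (suc (suc zero)) (s≤s (s≤s ()))
parallel-addition (suc (suc (suc a′))) _ = φ , φ-local , φ-conversion
  where open Construction a′

quotient : ℤ → (ℕ → ℤ) → ℕ → ℤ
quotient A d zero = + 0
quotient A d (suc zero) = + 0
quotient A d (suc (suc k)) = d k - quotient A d k + A * quotient A d (suc k)

Δ²-quotient : ∀ A d k → Δ² A (quotient A d) k ≡ d k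
Δ²-quotient A d k = cancel A (d k) (quotient A d k) (quotient A d (suc k))
  where
  cancel : ∀ A d p₀ p₁ → p₀ + (d - p₀ + A * p₁) - A * p₁ ≡ d
  cancel = solve-∀

-- A vanishing Σ d_k β^(k−K) means that X² − aX + 1 divides Σ d_k X^k,
-- so the division from below leaves no remainder.
exact-division : ∀ a K (d : ℕ → ℤ) →
                 ∑ (suc (K ℕ.+ K)) (λ k → d k * βpow₀ a (pos K k)) ≡ + 0 →
                 ∑ (suc (K ℕ.+ K)) (λ k → d k * βpow₁ a (pos K k)) ≡ + 0 →
                 quotient (+ a) d (suc (suc (K ℕ.+ K))) ≡ + 0 × quotient (+ a) d (suc (K ℕ.+ K)) ≡ + 0
exact-division a K d sum₀ sum₁ =
  βpow-independent a (pos (suc K) n) (P (suc n)) (P n) (top (βpow₀ a) (βpow₀-recurrent a) sum₀) (top (βpow₁ a) (βpow₁-recurrent a) sum₁)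
  where
  open ≡-Reasoning
  n = suc (K ℕ.+ K)
  P = quotient (+ a) d
  top : ∀ C → Recurrent (+ a) C → ∑ n (λ k → d k * C (pos K k)) ≡ + 0 →
        P (suc n) * C (pos (suc K) n) ≡ P n * C (ℤ.suc (pos (suc K) n))
  top C recurrence sum = begin
    P (suc n) * C (pos (suc K) n)                              ≡⟨ ℤP.i-j≡0⇒i≡j _ _ casoratian≡0 ⟩
    P n * C (pos (suc K) (suc n))                              ≡⟨ cong (λ j → P n * C j) (pos-suc (suc K) n) ⟩
    P n * C (ℤ.suc (pos (suc K) n))                            ∎
    where
    c : ℕ → ℤ
    c i = C (pos (suc K) i)
    casoratian≡0 : casoratian P c n ≡ + 0
    casoratian≡0 = begin
      casoratian P c n                                         ≡⟨ sym (ℤP.+-identityʳ _) ⟩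
      casoratian P c n - casoratian P c 0
        ≡⟨ ∑-by-parts (+ a) c (recurrent-along (+ a) C recurrence (suc K)) n P ⟨
      ∑ n (λ k → Δ² (+ a) P k * c (suc k))
        ≡⟨ ∑-cong n (λ k → cong₂ _*_ (Δ²-quotient (+ a) d k) (cong C (pos-suc-suc K k))) ⟩
      ∑ n (λ k → d k * C (pos K k))                            ≡⟨ sum ⟩
      + 0                                                      ∎

Ascending : ℤ → ℤ → Set
Ascending x y = (x ≡ + 0 × y ≡ + 0) ⊎ ∣ x ∣ ℕ.< ∣ y ∣

ascending-from-0 : ∀ y → Ascending (+ 0) y
ascending-from-0 y with y ℤ.≟ + 0
... | yes y≡0 = inj₁ (refl , y≡0)
... | no y≢0 = inj₂ (ℕP.n≢0⇒n>0 (λ ∣y∣≡0 → y≢0 (ℤP.∣i∣≡0⇒i≡0 ∣y∣≡0)))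

middle-bound : ∀ a p₀ p₁ p₂ d → p₀ + p₂ - + a * p₁ ≡ d → a ℕ.* ∣ p₁ ∣ ≤ (∣ p₀ ∣ ℕ.+ ∣ p₂ ∣) ℕ.+ ∣ d ∣
middle-bound a p₀ p₁ p₂ d relation = begin
  a ℕ.* ∣ p₁ ∣             ≡⟨ ℤP.∣i*j∣≡∣i∣*∣j∣ (+ a) p₁ ⟨
  ∣ + a * p₁ ∣             ≡⟨ cong ∣_∣ (solve-for-middle (+ a) p₀ p₁ p₂ d relation) ⟩
  ∣ p₀ + p₂ - d ∣          ≤⟨ ℤP.∣i-j∣≤∣i∣+∣j∣ (p₀ + p₂) d ⟩
  ∣ p₀ + p₂ ∣ ℕ.+ ∣ d ∣    ≤⟨ ℕP.+-monoˡ-≤ ∣ d ∣ (ℤP.∣i+j∣≤∣i∣+∣j∣ p₀ p₂) ⟩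
  (∣ p₀ ∣ ℕ.+ ∣ p₂ ∣) ℕ.+ ∣ d ∣ ∎
  where
  open ℕP.≤-Reasoning
  solve-for-middle : ∀ A p₀ p₁ p₂ d → p₀ + p₂ - A * p₁ ≡ d → A * p₁ ≡ p₀ + p₂ - d
  solve-for-middle A p₀ p₁ p₂ _ refl = rearrange A p₀ p₁ p₂
    where
    rearrange : ∀ A p₀ p₁ p₂ → A * p₁ ≡ p₀ + p₂ - (p₀ + p₂ - A * p₁)
    rearrange = solve-∀

-- (a − 2)(p − 1) ≥ 0, i.e. a p + 2 ≥ 2p + a
ap+3≰2p+a : ∀ a p → 2 ≤ a → 1 ≤ p → ¬ (a ℕ.* p ℕ.+ 3 ≤ p ℕ.+ p ℕ.+ a)
ap+3≰2p+a (suc zero) _ (s≤s ()) _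
ap+3≰2p+a (suc (suc a″)) (suc q) _ _ le =
  ℕP.<-irrefl refl (ℕP.≤-trans (s≤s (ℕP.m≤m+n _ (a″ ℕ.* q))) (ℕP.≤-trans (ℕP.≤-reflexive (expand a″ q)) le))
  where
  expand : ∀ a″ q → suc (suc q ℕ.+ suc q ℕ.+ suc (suc a″) ℕ.+ a″ ℕ.* q) ≡ suc (suc a″) ℕ.* suc q ℕ.+ 3
  expand = ℕ-Solver.solve-∀

ascending-step : ∀ a p₀ p₁ p₂ d → 2 ≤ a → p₀ + p₂ - + a * p₁ ≡ d → ∣ d ∣ ℕ.+ 2 ≤ a →
                 Ascending p₀ p₁ → Ascending p₁ p₂
ascending-step a p₀ p₁ p₂ d 2≤a relation small (inj₁ (_ , refl)) = ascending-from-0 p₂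
ascending-step a p₀ p₁ p₂ d 2≤a relation small (inj₂ p₀<p₁) with ∣ p₁ ∣ ℕ.<? ∣ p₂ ∣
... | yes p₁<p₂ = inj₂ p₁<p₂
... | no p₁≮p₂ = ⊥-elim (ap+3≰2p+a a ∣ p₁ ∣ 2≤a (ℕP.<-≤-trans (s≤s z≤n) p₀<p₁) bound)
  where
  open ℕP.≤-Reasoning
  regroup : ∀ x z e → x ℕ.+ z ℕ.+ e ℕ.+ 3 ≡ suc x ℕ.+ z ℕ.+ (e ℕ.+ 2)
  regroup = ℕ-Solver.solve-∀
  bound : a ℕ.* ∣ p₁ ∣ ℕ.+ 3 ≤ (∣ p₁ ∣ ℕ.+ ∣ p₁ ∣) ℕ.+ a
  bound = begin
    a ℕ.* ∣ p₁ ∣ ℕ.+ 3                         ≤⟨ ℕP.+-monoˡ-≤ 3 (middle-bound a p₀ p₁ p₂ d relation) ⟩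
    (∣ p₀ ∣ ℕ.+ ∣ p₂ ∣) ℕ.+ ∣ d ∣ ℕ.+ 3          ≡⟨ regroup (∣ p₀ ∣) (∣ p₂ ∣) (∣ d ∣) ⟩
    (suc ∣ p₀ ∣ ℕ.+ ∣ p₂ ∣) ℕ.+ (∣ d ∣ ℕ.+ 2)    ≤⟨ ℕP.+-mono-≤ (ℕP.+-mono-≤ p₀<p₁ (ℕP.≮⇒≥ p₁≮p₂)) small ⟩
    (∣ p₁ ∣ ℕ.+ ∣ p₁ ∣) ℕ.+ a                    ∎

ascending-peak : ∀ a p₀ p₁ p₂ d → 2 ≤ a → p₀ + p₂ - + a * p₁ ≡ d → 1 ≤ ∣ d ∣ → ∣ d ∣ ℕ.+ 1 ≤ a →
                 Ascending p₀ p₁ → Ascending p₂ p₁ → ⊥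
ascending-peak a p₀ p₁ p₂ d 2≤a relation nonzero small (inj₁ (refl , refl)) (inj₁ (refl , _))
  rewrite sym relation | ℤP.*-zeroʳ (+ a) with () ← nonzero
ascending-peak a p₀ p₁ p₂ d 2≤a relation nonzero small (inj₁ (_ , refl)) (inj₂ p₂<0) = ℕP.n≮0 p₂<0
ascending-peak a p₀ p₁ p₂ d 2≤a relation nonzero small (inj₂ p₀<0) (inj₁ (_ , refl)) = ℕP.n≮0 p₀<0
ascending-peak a p₀ p₁ p₂ d 2≤a relation nonzero small (inj₂ p₀<p₁) (inj₂ p₂<p₁) =
  ap+3≰2p+a a ∣ p₁ ∣ 2≤a (ℕP.<-≤-trans (s≤s z≤n) p₀<p₁) bound
  where
  open ℕP.≤-Reasoning
  regroup : ∀ x z e → x ℕ.+ z ℕ.+ e ℕ.+ 3 ≡ suc x ℕ.+ suc z ℕ.+ (e ℕ.+ 1)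
  regroup = ℕ-Solver.solve-∀
  bound : a ℕ.* ∣ p₁ ∣ ℕ.+ 3 ≤ (∣ p₁ ∣ ℕ.+ ∣ p₁ ∣) ℕ.+ a
  bound = begin
    a ℕ.* ∣ p₁ ∣ ℕ.+ 3                            ≤⟨ ℕP.+-monoˡ-≤ 3 (middle-bound a p₀ p₁ p₂ d relation) ⟩
    (∣ p₀ ∣ ℕ.+ ∣ p₂ ∣) ℕ.+ ∣ d ∣ ℕ.+ 3             ≡⟨ regroup (∣ p₀ ∣) (∣ p₂ ∣) (∣ d ∣) ⟩
    (suc ∣ p₀ ∣ ℕ.+ suc ∣ p₂ ∣) ℕ.+ (∣ d ∣ ℕ.+ 1)   ≤⟨ ℕP.+-mono-≤ (ℕP.+-mono-≤ p₀<p₁ p₂<p₁) small ⟩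
    (∣ p₁ ∣ ℕ.+ ∣ p₁ ∣) ℕ.+ a                       ∎

module _ (a : ℕ) (2≤a : 2 ≤ a) (P d : ℕ → ℤ) (Δ²P≡d : ∀ k → Δ² (+ a) P k ≡ d k) where

  ascend : ∀ i → (∀ k → k ℕ.< i → ∣ d k ∣ ℕ.+ 2 ≤ a) → Ascending (P 0) (P 1) → Ascending (P i) (P (suc i))
  ascend zero small bottom = bottom
  ascend (suc i) small bottom =
    ascending-step a (P i) (P (suc i)) (P (suc (suc i))) (d i) 2≤a (Δ²P≡d i) (small i ℕP.≤-refl)
      (ascend i (λ k k<i → small k (ℕP.m<n⇒m<1+n k<i)) bottom)

  descend : ∀ L i → (∀ k → k ℕ.< i → ∣ d (k ℕ.+ L) ∣ ℕ.+ 2 ≤ a) →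
            Ascending (P (suc (i ℕ.+ L))) (P (i ℕ.+ L)) → Ascending (P (suc L)) (P L)
  descend L zero small top = top
  descend L (suc i) small top =
    descend L i (λ k k<i → small k (ℕP.m<n⇒m<1+n k<i))
      (ascending-step a (P (suc (suc (i ℕ.+ L)))) (P (suc (i ℕ.+ L))) (P (i ℕ.+ L)) (d (i ℕ.+ L)) 2≤a
        (trans (cong (_- + a * P (suc (i ℕ.+ L))) (ℤP.+-comm (P (suc (suc (i ℕ.+ L)))) (P (i ℕ.+ L))))
               (Δ²P≡d (i ℕ.+ L)))
        (small i ℕP.≤-refl) top)

βpow-combination≢0 : ∀ a → 2 ≤ a → ∀ K (d : ℕ → ℤ) →
                     (∀ k → k ≢ K → ∣ d k ∣ ℕ.+ 2 ≤ a) → 1 ≤ ∣ d K ∣ → ∣ d K ∣ ℕ.+ 1 ≤ a →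
                     ∑ (suc (K ℕ.+ K)) (λ k → d k * βpow₀ a (pos K k)) ≡ + 0 →
                     ∑ (suc (K ℕ.+ K)) (λ k → d k * βpow₁ a (pos K k)) ≡ + 0 → ⊥
βpow-combination≢0 a 2≤a K d small nonzero medium sum₀ sum₁ =
  ascending-peak a (P K) (P (suc K)) (P (suc (suc K))) (d K) 2≤a (Δ²-quotient (+ a) d K) nonzero medium
    (ascend a 2≤a P d (Δ²-quotient (+ a) d) K (λ k k<K → small k (ℕP.<⇒≢ k<K)) (inj₁ (refl , refl)))
    (descend a 2≤a P d (Δ²-quotient (+ a) d) (suc K) K
      (λ k _ → small (k ℕ.+ suc K) (λ k+1+K≡K → ℕP.<⇒≢ (ℕP.m≤n+m (suc K) k) (sym k+1+K≡K)))
      (subst (λ t → Ascending (P (suc t)) (P t)) (sym (ℕP.+-suc K K)) (inj₁ (exact-division a K d sum₀ sum₁))))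
  where
  P = quotient (+ a) d

∣-∣≤width : ∀ {m M x y} → Icc m M x → Icc m M y → + ∣ x - y ∣ ℤ.≤ M - m
∣-∣≤width {m} {M} {x} {y} (m≤x , x≤M) (m≤y , y≤M) with ℤP.≤-total x y
... | inj₁ x≤y = subst (ℤ._≤ M - m) (sym (ℤP.∣-∣-≤ x≤y)) (ℤP.+-mono-≤ y≤M (ℤP.neg-mono-≤ m≤x))
... | inj₂ y≤x = subst (ℤ._≤ M - m) (trans (sym (ℤP.∣-∣-≤ y≤x)) (cong +_ (ℤP.∣i-j∣≡∣j-i∣ y x))) (ℤP.+-mono-≤ x≤M (ℤP.neg-mono-≤ m≤y))

∣-∣-above : ∀ {x M} → x ℤ.≤ M → ∣ x - (M + + 1) ∣ ≡ ∣ x - M ∣ ℕ.+ 1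
∣-∣-above {x} {M} x≤M = ℤP.+-injective (begin
  + ∣ x - (M + + 1) ∣    ≡⟨ ℤP.∣-∣-≤ (ℤP.≤-trans x≤M (ℤP.i≤i+j M (+ 1))) ⟩
  M + + 1 - x            ≡⟨ shift M x ⟩
  M - x + + 1            ≡⟨ cong (_+ + 1) (sym (ℤP.∣-∣-≤ x≤M)) ⟩
  + ∣ x - M ∣ + + 1      ∎)
  where
  open ≡-Reasoning
  shift : ∀ M x → M + + 1 - x ≡ M - x + + 1
  shift = solve-∀

w≤width⇒w+2≤a : ∀ a w {width} → + w ℤ.≤ width → width + + 1 < + a → w ℕ.+ 2 ≤ a
w≤width⇒w+2≤a a w w≤width width<a =
  subst (_≤ a) (sym (ℕP.+-suc w 1)) (ℤP.drop‿+<+ (ℤP.≤-<-trans (ℤP.+-monoˡ-≤ (+ 1) w≤width) width<a))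

module _ (a : ℕ) {m M : ℤ} (m≤0 : m ℤ.≤ + 0) (1≤M : + 1 ℤ.≤ M) (width<a : (M - m) + + 1 < + a) where

  private
    A = Icc m M
    0∈A : A (+ 0)
    0∈A = m≤0 , ℤP.≤-trans (ℤ.+≤+ z≤n) 1≤M
    1∈A : A (+ 1)
    1∈A = ℤP.≤-trans m≤0 (ℤ.+≤+ z≤n) , 1≤M
    M∈A : A M
    M∈A = ℤP.≤-trans m≤0 (proj₂ 0∈A) , ℤP.≤-refl

  spike : Seq (A ⊞ A)
  spike (+ zero) = M + + 1 , M , + 1 , M∈A , 1∈A , refl
  spike (+ suc _) = + 0 , + 0 , + 0 , 0∈A , 0∈A , refl
  spike -[1+ _ ] = + 0 , + 0 , + 0 , 0∈A , 0∈A , refl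

  spike-off : ∀ j → j ≢ + 0 → digits spike j ≡ + 0
  spike-off (+ zero) j≢0 = ⊥-elim (j≢0 refl)
  spike-off (+ suc _) _ = refl
  spike-off -[1+ _ ] _ = refl

  spike-finite : FinSupp 0 spike
  spike-finite j 0<∣j∣ = spike-off j (λ { refl → ℕP.<-irrefl refl 0<∣j∣ })

  no-digit-conversion : (φ : Seq (A ⊞ A) → Seq A) → ¬ IsDigitConversion a (A ⊞ A) A φ
  no-digit-conversion φ conversion =
    βpow-combination≢0 a (w≤width⇒w+2≤a a 0 (∣-∣≤width 0∈A 0∈A) width<a) K d small nonzero medium
      (coordSum-difference (βpow₀ a) K (digits spike) (digits v) (cong proj₁ coordinates))
      (coordSum-difference (βpow₁ a) K (digits spike) (digits v) (cong proj₂ coordinates))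
    where
    K = proj₁ (conversion spike 0 spike-finite)
    v = φ spike
    coordinates = trans (sym (val-coordinates a K spike)) (trans (proj₂ (proj₂ (conversion spike 0 spike-finite))) (val-coordinates a K v))
    d : ℕ → ℤ
    d k = digits v (pos K k) - digits spike (pos K k)
    v∈A : ∀ j → A (digits v j)
    v∈A j = proj₂ (v j)
    small : ∀ k → k ≢ K → ∣ d k ∣ ℕ.+ 2 ≤ a
    small k k≢K = subst (λ t → ∣ digits v (pos K k) - t ∣ ℕ.+ 2 ≤ a)
      (sym (spike-off (pos K k) (λ pos≡0 → k≢K (ℤP.+-injective (ℤP.i-j≡0⇒i≡j (+ k) (+ K) pos≡0)))))
      (w≤width⇒w+2≤a a _ (∣-∣≤width (v∈A (pos K k)) 0∈A) width<a)
    centre : ∣ d K ∣ ≡ ∣ digits v (pos K K) - M ∣ ℕ.+ 1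
    centre = trans (cong (λ j → ∣ digits v (pos K K) - digits spike j ∣) (ℤP.+-inverseʳ (+ K)))
                   (∣-∣-above (proj₂ (v∈A (pos K K))))
    nonzero : 1 ≤ ∣ d K ∣
    nonzero = subst (1 ≤_) (sym centre) (ℕP.m≤n+m 1 _)
    medium : ∣ d K ∣ ℕ.+ 1 ≤ a
    medium = subst (λ t → t ℕ.+ 1 ≤ a) (sym centre)
      (subst (_≤ a) (sym (ℕP.+-assoc _ 1 1)) (w≤width⇒w+2≤a a _ (∣-∣≤width (v∈A (pos K K)) M∈A) width<a))

theorem33 : (a : ℕ) → 3 ≤ a →
    (Σ (Seq (Icc (+ 0) (+ a - + 1) ⊞ Icc (+ 0) (+ a - + 1)) → Seq (Icc (+ 0) (+ a - + 1))) λ φ →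
    IsLocal (Icc (+ 0) (+ a - + 1) ⊞ Icc (+ 0) (+ a - + 1)) (Icc (+ 0) (+ a - + 1)) φ 11
    × IsDigitConversion a (Icc (+ 0) (+ a - + 1) ⊞ Icc (+ 0) (+ a - + 1)) (Icc (+ 0) (+ a - + 1)) φ)
    × ((m M : ℤ) → m Data.Integer.≤ + 0 → + 1 Data.Integer.≤ M → (M - m) + + 1 < + a →
    ¬ AllowsParallelAddition a (Icc m M))
theorem33 a 3≤a = parallel-addition a 3≤a , λ m M m≤0 1≤M width<a (_ , φ , _ , conversion) →
  no-digit-conversion a m≤0 1≤M width<a φ conversion
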